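{- Let $G_1$ be a connected graph and $T$ a tree. If $\Delta(T)>|V(G_1)|$, then $G_1\square T$ is not $1$-tough.
   Context: All graphs are finite and simple. $\Delta(T)$ is the maximum degree. The Cartesian product $G_1\square G_2$ has vertex set $\{v_u : v\in V(G_1), u\in V(G_2)\}$, with $v_u v_w$ an edge whenever $uw\in E(G_2)$, and $v_u w_u$ an edge whenever $vw\in E(G_1)$. For $S\subseteq V(G)$, $c(G-S)$ is the number of components of the subgraph induced on $V(G)\setminus S$; $G$ is $1$-tough if $|S|\geq c(G-S)$ for every $S\subseteq V(G)$ with $c(G-S)\geq 2$. -}

module Defs where

open import Data.Nat using (ℕ; zero; suc; _+_; _≤_; _<_; _⊔_)
open import Data.Bool using (Bool; true; false; _∧_; _∨_; if_then_else_)
open import Data.Fin using (Fin; zero; suc; inject₁; fromℕ; remQuot; _≟_)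
open import Data.Fin.Subset using (Subset; _∉_; ∣_∣)
open import Data.List using (List; map; foldr; allFin)
open import Data.Nat.ListAction using (sum)
open import Data.Product using (Σ; ∃; _×_; _,_; proj₁; proj₂)
open import Relation.Binary.PropositionalEquality using (_≡_)
open import Relation.Nullary using (¬_)
open import Relation.Nullary.Decidable using (⌊_⌋)
open import Function using (_⇔_)
open import Function.Definitions using (Injective)

record Graph : Set where
  field
    n     : ℕ
    Adj   : Fin n → Fin n → Bool
    sym   : ∀ u v → Adj u v ≡ Adj v u
    loopless : ∀ v → Adj v v ≡ false
open Graph public

order : Graph → ℕ
order G = n G

-- degree of a vertex, and maximum degree Δ(G) (Δ = 0 for the empty graph)
degree : (G : Graph) → Fin (n G) → ℕ
degree G v = sum (map (λ w → if Adj G v w then 1 else 0) (allFin (n G)))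

Δ : Graph → ℕ
Δ G = foldr _⊔_ 0 (map (degree G) (allFin (n G)))

data Reach (G : Graph) (S : Subset (n G)) : Fin (n G) → Fin (n G) → Set where
  here : ∀ {u} → u ∉ S → Reach G S u u
  step : ∀ {u w v} → u ∉ S → Adj G u w ≡ true → Reach G S w v → Reach G S u v

Walk : (G : Graph) → Fin (n G) → Fin (n G) → Set
Walk G u v = Reach G (Data.Fin.Subset.⊥) u v

Connected : Graph → Set
Connected G = (1 ≤ n G) × (∀ u v → Walk G u v)

-- a cycle: k+3 distinct vertices c_0,…,c_{k+2} with consecutive ones adjacent
-- and c_{k+2} adjacent to c_0
record Cycle (G : Graph) : Set where
  field
    k   : ℕ
    c   : Fin (suc (suc (suc k))) → Fin (n G)
    inj : Injective _≡_ _≡_ c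
    adj : ∀ i → Adj G (c (inject₁ i)) (c (suc i)) ≡ true
    close : Adj G (c (fromℕ (suc (suc k)))) (c zero) ≡ true

Acyclic : Graph → Set
Acyclic G = ¬ Cycle G

IsTree : Graph → Set
IsTree T = Connected T × Acyclic T

-- Cartesian product G₁ □ G₂, vertex v_u encoded as combine v u ∈ Fin (n₁ * n₂)
_□_ : Graph → Graph → Graph
G₁ □ G₂ = record
  { n = Data.Nat._*_ (n G₁) (n G₂)
  ; Adj = A
  ; sym = λ x y → symA x y
  ; loopless = λ x → loopA x
  }
  where
  open import Data.Bool.Properties using (∨-comm)
  open import Relation.Binary.PropositionalEquality using (refl; cong₂; trans)
  open import Data.Empty using (⊥-elim)
  eqb : ∀ {m} → Fin m → Fin m → Bool
  eqb a b = ⌊ a ≟ b ⌋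
  P : Set
  P = Fin (n G₁) × Fin (n G₂)
  B : P → P → Bool
  B (v , u) (w , u') = (eqb v w ∧ Adj G₂ u u') ∨ (eqb u u' ∧ Adj G₁ v w)
  A : Fin (Data.Nat._*_ (n G₁) (n G₂)) → Fin (Data.Nat._*_ (n G₁) (n G₂)) → Bool
  A x y = B (remQuot (n G₂) x) (remQuot (n G₂) y)
  eqb-sym : ∀ {m} (a b : Fin m) → eqb a b ≡ eqb b a
  eqb-sym a b with a ≟ b | b ≟ a
  ... | Relation.Nullary.yes _ | Relation.Nullary.yes _ = refl
  ... | Relation.Nullary.no _ | Relation.Nullary.no _ = refl
  ... | Relation.Nullary.yes p | Relation.Nullary.no q = ⊥-elim (q (Relation.Binary.PropositionalEquality.sym p))
  ... | Relation.Nullary.no p | Relation.Nullary.yes q = ⊥-elim (p (Relation.Binary.PropositionalEquality.sym q))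
  eqb-refl : ∀ {m} (a : Fin m) → eqb a a ≡ true
  eqb-refl a with a ≟ a
  ... | Relation.Nullary.yes _ = refl
  ... | Relation.Nullary.no p = ⊥-elim (p refl)
  symB : ∀ p q → B p q ≡ B q p
  symB (v , u) (w , u') =
    cong₂ _∨_ (cong₂ _∧_ (eqb-sym v w) (Graph.sym G₂ u u'))
              (cong₂ _∧_ (eqb-sym u u') (Graph.sym G₁ v w))
  symA : ∀ x y → A x y ≡ A y x
  symA x y = symB (remQuot (n G₂) x) (remQuot (n G₂) y)
  loopB : ∀ p → B p p ≡ false
  loopB (v , u) rewrite eqb-refl v | eqb-refl u | loopless G₂ u | loopless G₁ v = refl
  loopA : ∀ x → A x x ≡ false
  loopA x = loopB (remQuot (n G₂) x)

-- G - S has exactly k components: a labelling of the vertices outside S by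
-- Fin k, onto, with two vertices equally labelled iff joined by a walk in G - S
Components : (G : Graph) → Subset (n G) → ℕ → Set
Components G S k =
  Σ ((v : Fin (n G)) → v ∉ S → Fin k) λ f →
    (∀ (i : Fin k) → ∃ λ v → Σ (v ∉ S) λ p → f v p ≡ i) ×
    (∀ u v (pu : u ∉ S) (pv : v ∉ S) → (f u pu ≡ f v pv) ⇔ Reach G S u v)

OneTough : Graph → Set
OneTough G = ∀ (S : Subset (n G)) (k : ℕ) → Components G S k → 2 ≤ k → k ≤ ∣ S ∣

module Submission where

-- Let v be a vertex of the tree T with deg(v) > |V(G₁)| and let S be the
-- "cylinder" V(G₁) × {v} in G₁ □ T, so |S| = |V(G₁)|.  Deleting v from T
-- leaves exactly deg(v) components, one for each neighbour a of v: every
-- vertex of T − v reaches v through a unique such neighbour, since two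
-- neighbours joined in T − v would close a cycle through v.  Because G₁ is
-- connected, the components of (G₁ □ T) − S are exactly the preimages of the
-- components of T − v under the projection to T.  Hence S separates G₁ □ T
-- into deg(v) ≥ 2 components while |S| < deg(v), so G₁ □ T is not 1-tough.

open import Defs hiding (sym)
open import Data.Nat using (ℕ; zero; suc; _+_; _*_; _⊔_; _≤_; _<_; s≤s)
open import Data.Nat.Properties using (≤-trans; <⇒≱; n≮0; ⊔-sel; *-identityʳ; module ≤-Reasoning)
open import Data.Bool using (Bool; true; false; _∧_; _∨_; if_then_else_)
import Data.Bool as Bool
open import Data.Bool.Properties using (∨-zeroʳ)
open import Data.Fin using (Fin; zero; suc; inject₁; fromℕ; fromℕ<; combine; remQuot; _≟_)
open import Data.Fin.Properties using (any?; remQuot-combine; combine-remQuot)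
open import Data.Fin.Subset using (Subset; _∈_; _∉_; ⁅_⁆; ∣_∣)
open import Data.Fin.Subset.Properties using (_∈?_; x∈⁅x⁆; x∈⁅y⁆⇒x≡y; ∣⁅x⁆∣≡1)
open import Data.List using (List; []; _∷_; map; filter; length; lookup; allFin)
open import Data.List.Relation.Unary.Any using (index)
open import Data.List.Relation.Unary.Any.Properties using (lookup-index)
open import Data.List.Membership.Propositional using () renaming (_∈_ to _∈ₗ_)
open import Data.List.Membership.Propositional.Properties
  using (∈-filter⁺; ∈-filter⁻; ∈-allFin; ∈-lookup; ∈-map⁻; foldr-selective)
open import Data.List.Membership.Setoid.Properties using (unique⇒irrelevant)
open import Data.List.Relation.Unary.Unique.Propositional using (Unique)
open import Data.List.Relation.Unary.Unique.Propositional.Properties using (filter⁺; allFin⁺)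
open import Data.Nat.ListAction using (sum)
import Data.Vec as Vec
open import Data.Vec using ([]; _∷_; concat; replicate)
open import Data.Vec.Properties using (lookup-concat; lookup-replicate; []=⇒lookup; lookup⇒[]=)
open import Data.Product using (Σ; ∃; _×_; _,_; proj₁; proj₂)
open import Data.Sum using (_⊎_; inj₁; inj₂)
open import Data.Unit using (⊤; tt)
open import Data.Empty using (⊥-elim)
open import Function using (_⇔_; mk⇔; Equivalence)
open import Axiom.UniquenessOfIdentityProofs using (module Decidable⇒UIP)
open import Relation.Binary.Definitions using (DecidableEquality)
open import Relation.Nullary using (¬_; yes; no)
open import Relation.Nullary.Decidable using (⌊_⌋; dec-true; isYes≗does)
open import Relation.Binary.PropositionalEquality
  using (_≡_; _≢_; refl; sym; trans; cong; cong₂; subst; subst₂; setoid; module ≡-Reasoning)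

module _ {G : Graph} {S : Subset (n G)} where

  _++ᴿ_ : ∀ {u w x} → Reach G S u w → Reach G S w x → Reach G S u x
  here _ ++ᴿ r′ = r′
  step p e r ++ᴿ r′ = step p e (r ++ᴿ r′)

  start∉ : ∀ {u w} → Reach G S u w → u ∉ S
  start∉ (here p) = p
  start∉ (step p _ _) = p

  reverse : ∀ {u w} → Reach G S u w → Reach G S w u
  reverse (here p) = here p
  reverse (step p e r) = reverse r ++ᴿ step (start∉ r) (trans (Graph.sym G _ _) e) (here p)

  steps : ∀ {u w} → Reach G S u w → ℕ
  steps (here _) = zero
  steps (step _ _ r) = suc (steps r)

  vertex : ∀ {u w} (r : Reach G S u w) → Fin (suc (steps r)) → Fin (n G)
  vertex {u} r zero = u
  vertex (step _ _ r) (suc i) = vertex r i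

  vertex-last : ∀ {u w} (r : Reach G S u w) → vertex r (fromℕ (steps r)) ≡ w
  vertex-last (here _) = refl
  vertex-last (step _ _ r) = vertex-last r

  vertex-adjacent : ∀ {u w} (r : Reach G S u w) (j : Fin (steps r)) →
                    Adj G (vertex r (inject₁ j)) (vertex r (suc j)) ≡ true
  vertex-adjacent (step _ e r) zero = e
  vertex-adjacent (step _ _ r) (suc j) = vertex-adjacent r j

  vertex∉ : ∀ {u w} (r : Reach G S u w) i → vertex r i ∉ S
  vertex∉ r zero = start∉ r
  vertex∉ (step _ _ r) (suc i) = vertex∉ r i

  Simple : ∀ {u w} → Reach G S u w → Set
  Simple (here _) = ⊤
  Simple {u} (step _ _ r) = (∀ i → vertex r i ≢ u) × Simple r

  vertex-injective : ∀ {u w} (r : Reach G S u w) → Simple r → ∀ {i j} → vertex r i ≡ vertex r j → i ≡ j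
  vertex-injective r s {zero} {zero} eq = refl
  vertex-injective (step _ _ r) (new , _) {zero} {suc j} eq = ⊥-elim (new j (sym eq))
  vertex-injective (step _ _ r) (new , _) {suc i} {zero} eq = ⊥-elim (new i eq)
  vertex-injective (step _ _ r) (_ , s) {suc i} {suc j} eq = cong suc (vertex-injective r s eq)

  SimpleReach : Fin (n G) → Fin (n G) → Set
  SimpleReach u w = Σ (Reach G S u w) Simple

  suffix : ∀ {u w} (r : Reach G S u w) → Simple r → ∀ i → SimpleReach (vertex r i) w
  suffix r s zero = r , s
  suffix (step _ _ r) (_ , s) (suc i) = suffix r s i

  -- Every walk can be shortened to a simple one: shorten the tail, and if the
  -- first vertex reappears in it, keep only the part after that reappearance.
  shorten : ∀ {u w} → Reach G S u w → SimpleReach u w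
  shorten (here p) = here p , tt
  shorten {u} {w} (step p e r) with shorten r
  ... | r′ , s with any? (λ i → vertex r′ i ≟ u)
  ... | yes (i , eq) = subst (λ x → SimpleReach x w) eq (suffix r′ s i)
  ... | no fresh = step p e r′ , (λ i eq → fresh (i , eq)) , s

  -- A simple walk a … b in G − S with at least one edge, together with a
  -- vertex v ∈ S adjacent to both ends, forms the cycle v a … b.
  cycleThrough : ∀ {v a x b} → v ∈ S → Adj G v a ≡ true → Adj G b v ≡ true →
                 (p : a ∉ S) (e : Adj G a x ≡ true) (r : Reach G S x b) → Simple (step p e r) → Cycle G
  cycleThrough {v} {a} {x} {b} v∈S va bv p e r s = record
    { k = steps r ; c = c ; inj = c-injective ; adj = c-adjacent
    ; close = subst (λ y → Adj G y v ≡ true) (sym (vertex-last r)) bv }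
    where
    walk : Reach G S a b
    walk = step p e r
    c : Fin (suc (suc (suc (steps r)))) → Fin (n G)
    c zero = v
    c (suc i) = vertex walk i
    c-injective : ∀ {i j} → c i ≡ c j → i ≡ j
    c-injective {zero} {zero} eq = refl
    c-injective {zero} {suc j} eq = ⊥-elim (vertex∉ walk j (subst (_∈ S) eq v∈S))
    c-injective {suc i} {zero} eq = ⊥-elim (vertex∉ walk i (subst (_∈ S) (sym eq) v∈S))
    c-injective {suc i} {suc j} eq = cong suc (vertex-injective walk s eq)
    c-adjacent : ∀ i → Adj G (c (inject₁ i)) (c (suc i)) ≡ true
    c-adjacent zero = va
    c-adjacent (suc j) = vertex-adjacent walk j

  acyclic-separates : Acyclic G → ∀ {v a b} → v ∈ S → Adj G v a ≡ true → Adj G b v ≡ true →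
                      Reach G S a b → a ≡ b
  acyclic-separates acyclic v∈S va bv r with shorten r
  ... | here _ , _ = refl
  ... | step p e r′ , s = ⊥-elim (acyclic (cycleThrough v∈S va bv p e r′ s))

  exit : ∀ {t x} → Walk G t x → x ∈ S → t ∉ S →
         ∃ λ a → ∃ λ s → s ∈ S × Adj G a s ≡ true × Reach G S t a
  exit (here _) x∈S t∉S = ⊥-elim (t∉S x∈S)
  exit {t} (step {w = w} _ e r) x∈S t∉S with w ∈? S
  ... | yes w∈S = t , w , w∈S , e , here t∉S
  ... | no w∉S with exit r x∈S w∉S
  ...   | a , s , s∈S , as , r′ = a , s , s∈S , as , step t∉S e r′

module _ {A : Set} {xs : List A} where

  position-injective : ∀ {x y} (p : x ∈ₗ xs) (q : y ∈ₗ xs) → index p ≡ index q → x ≡ y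
  position-injective p q same = trans (lookup-index p) (trans (cong (lookup xs) same) (sym (lookup-index q)))

  position-irrelevant : DecidableEquality A → Unique xs → ∀ {x} (p q : x ∈ₗ xs) → index p ≡ index q
  position-irrelevant _≟ᴬ_ unique p q =
    cong index (unique⇒irrelevant (setoid A) (Decidable⇒UIP.≡-irrelevant _≟ᴬ_) unique p q)

index-∈-lookup : ∀ {A : Set} (xs : List A) i → index (∈-lookup {xs = xs} i) ≡ i
index-∈-lookup (x ∷ xs) zero = refl
index-∈-lookup (x ∷ xs) (suc i) = cong suc (index-∈-lookup xs i)

sum-indicator : ∀ {A : Set} (p : A → Bool) xs →
                sum (map (λ x → if p x then 1 else 0) xs) ≡ length (filter (λ x → p x Bool.≟ true) xs)
sum-indicator p [] = refl
sum-indicator p (x ∷ xs) with p x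
... | true = cong suc (sum-indicator p xs)
... | false = sum-indicator p xs

neighbours : (G : Graph) → Fin (n G) → List (Fin (n G))
neighbours G v = filter (λ w → Adj G v w Bool.≟ true) (allFin (n G))

degree≡length : ∀ G v → degree G v ≡ length (neighbours G v)
degree≡length G v = sum-indicator (Adj G v) (allFin (n G))

neighbour≢ : ∀ G {v a} → Adj G v a ≡ true → a ≢ v
neighbour≢ G {v} va refl with trans (sym (loopless G v)) va
... | ()

-- Removing a vertex v from a tree leaves deg(v) components; the component of
-- t is labelled by the position of the neighbour of v through which t reaches v.
module TreeMinusVertex (G : Graph) (tree : IsTree G) (v : Fin (n G)) where

  Gate : Fin (n G) → Set
  Gate t = Σ (Fin (n G)) λ a → Adj G v a ≡ true × Reach G ⁅ v ⁆ t a

  gate : ∀ t → t ∉ ⁅ v ⁆ → Gate t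
  gate t t∉ with exit (proj₂ (proj₁ tree) t v) (x∈⁅x⁆ v) t∉
  ... | a , s , s∈ , as , r = a , trans (Graph.sym G v a) (subst (λ y → Adj G a y ≡ true) (x∈⁅y⁆⇒x≡y v s∈) as) , r

  -- Gates are unique, since distinct neighbours of v are separated in G − v.
  same-gate : ∀ {a b} → Adj G v a ≡ true → Adj G v b ≡ true → Reach G ⁅ v ⁆ a b → a ≡ b
  same-gate va vb = acyclic-separates (proj₂ tree) (x∈⁅x⁆ v) va (trans (Graph.sym G _ v) vb)

  ∈-neighbours : ∀ {a} → Adj G v a ≡ true → a ∈ₗ neighbours G v
  ∈-neighbours va = ∈-filter⁺ (λ w → Adj G v w Bool.≟ true) (∈-allFin _) va

  slot : ∀ {a} → Adj G v a ≡ true → Fin (length (neighbours G v))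
  slot va = index (∈-neighbours va)

  slot-irrelevant : ∀ {a} (p : a ∈ₗ neighbours G v) (va : Adj G v a ≡ true) → index p ≡ slot va
  slot-irrelevant p va = position-irrelevant _≟_ (filter⁺ _ (allFin⁺ (n G))) p (∈-neighbours va)

  slot-cong : ∀ {a b} (va : Adj G v a ≡ true) (vb : Adj G v b ≡ true) → a ≡ b → slot va ≡ slot vb
  slot-cong va vb refl = slot-irrelevant (∈-neighbours va) vb

  label : (t : Fin (n G)) → t ∉ ⁅ v ⁆ → Fin (length (neighbours G v))
  label t t∉ = slot (proj₁ (proj₂ (gate t t∉)))

  label-respects : ∀ {t t′} t∉ t′∉ → Reach G ⁅ v ⁆ t t′ → label t t∉ ≡ label t′ t′∉
  label-respects t∉ t′∉ r =
    let (a , va , ra) = gate _ t∉ ; (a′ , va′ , ra′) = gate _ t′∉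
    in slot-cong va va′ (same-gate va va′ (reverse ra ++ᴿ (r ++ᴿ ra′)))

  label-reflects : ∀ {t t′} t∉ t′∉ → label t t∉ ≡ label t′ t′∉ → Reach G ⁅ v ⁆ t t′
  label-reflects {t′ = t′} t∉ t′∉ same =
    let (a , va , ra) = gate _ t∉ ; (a′ , va′ , ra′) = gate _ t′∉
        a≡a′ = position-injective (∈-neighbours va) (∈-neighbours va′) same
    in ra ++ᴿ subst (λ x → Reach G ⁅ v ⁆ x t′) (sym a≡a′) (reverse ra′)

  -- The i-th neighbour of v is its own gate, so it carries label i.
  label-onto : ∀ i → ∃ λ t → Σ (t ∉ ⁅ v ⁆) λ t∉ → label t t∉ ≡ i
  label-onto i = a , a∉ , (begin
      label a a∉  ≡⟨ slot-cong va′ va (sym (same-gate va va′ ra′)) ⟩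
      slot va     ≡⟨ sym (slot-irrelevant a∈N va) ⟩
      index a∈N   ≡⟨ index-∈-lookup (neighbours G v) i ⟩
      i           ∎)
    where
    open ≡-Reasoning
    a : Fin (n G)
    a = lookup (neighbours G v) i
    a∈N : a ∈ₗ neighbours G v
    a∈N = ∈-lookup i
    va : Adj G v a ≡ true
    va = proj₂ (∈-filter⁻ (λ w → Adj G v w Bool.≟ true) {xs = allFin (n G)} a∈N)
    a∉ : a ∉ ⁅ v ⁆
    a∉ a∈ = neighbour≢ G va (x∈⁅y⁆⇒x≡y v a∈)
    va′ : Adj G v (proj₁ (gate a a∉)) ≡ true
    va′ = proj₁ (proj₂ (gate a a∉))
    ra′ : Reach G ⁅ v ⁆ a (proj₁ (gate a a∉))
    ra′ = proj₂ (proj₂ (gate a a∉))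

  components : Components G ⁅ v ⁆ (degree G v)
  components = subst (Components G ⁅ v ⁆) (sym (degree≡length G v))
    (label , label-onto , λ t t′ t∉ t′∉ → mk⇔ (label-reflects t∉ t′∉) (label-respects t∉ t′∉))

∣++∣ : ∀ {k l} (p : Subset k) (q : Subset l) → ∣ p Vec.++ q ∣ ≡ ∣ p ∣ + ∣ q ∣
∣++∣ [] q = refl
∣++∣ (true ∷ p) q = cong suc (∣++∣ p q)
∣++∣ (false ∷ p) q = ∣++∣ p q

∣concat-replicate∣ : ∀ {l} m (S : Subset l) → ∣ concat (replicate m S) ∣ ≡ m * ∣ S ∣
∣concat-replicate∣ zero S = refl
∣concat-replicate∣ (suc m) S = trans (∣++∣ S (concat (replicate m S))) (cong (∣ S ∣ +_) (∣concat-replicate∣ m S))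

⌊≟⌋-refl : ∀ {m} (t : Fin m) → ⌊ t ≟ t ⌋ ≡ true
⌊≟⌋-refl t = trans (isYes≗does (t ≟ t)) (dec-true (t ≟ t) refl)

module _ (G H : Graph) where

  πG : Fin (n (G □ H)) → Fin (n G)
  πG x = proj₁ (remQuot {n G} (n H) x)

  πH : Fin (n (G □ H)) → Fin (n H)
  πH x = proj₂ (remQuot {n G} (n H) x)

  combine-π : ∀ x → combine (πG x) (πH x) ≡ x
  combine-π = combine-remQuot {n G} (n H)

  πH-combine : ∀ w t → πH (combine w t) ≡ t
  πH-combine w t = cong proj₂ (remQuot-combine {n G} w t)

  ProductEdge : Fin (n G) × Fin (n H) → Fin (n G) × Fin (n H) → Bool
  ProductEdge (w , t) (w′ , t′) = (⌊ w ≟ w′ ⌋ ∧ Adj H t t′) ∨ (⌊ t ≟ t′ ⌋ ∧ Adj G w w′)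

  □-adj-combine : ∀ w w′ t t′ → Adj (G □ H) (combine w t) (combine w′ t′) ≡ ProductEdge (w , t) (w′ , t′)
  □-adj-combine w w′ t t′ = cong₂ ProductEdge (remQuot-combine {n G} w t) (remQuot-combine {n G} w′ t′)

  □-edgeG : ∀ {w w′} t → Adj G w w′ ≡ true → Adj (G □ H) (combine w t) (combine w′ t) ≡ true
  □-edgeG {w} {w′} t e rewrite □-adj-combine w w′ t t | ⌊≟⌋-refl t | e = ∨-zeroʳ _

  □-edgeH : ∀ w {t t′} → Adj H t t′ ≡ true → Adj (G □ H) (combine w t) (combine w t′) ≡ true
  □-edgeH w {t} {t′} e rewrite □-adj-combine w w t t′ | ⌊≟⌋-refl w | e = refl

  □-adj⁻ : ∀ x y → Adj (G □ H) x y ≡ true → Adj H (πH x) (πH y) ≡ true ⊎ πH x ≡ πH y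
  □-adj⁻ x y = coordinatewise (πG x) (πG y) (πH x) (πH y)
    where
    impossible : ∀ b → (b ∧ false) ∨ false ≢ true
    impossible true ()
    impossible false ()
    coordinatewise : ∀ w w′ t t′ → ProductEdge (w , t) (w′ , t′) ≡ true → Adj H t t′ ≡ true ⊎ t ≡ t′
    coordinatewise w w′ t t′ e with Adj H t t′ | t ≟ t′
    ... | true | _ = inj₁ refl
    ... | false | yes same = inj₂ same
    ... | false | no _ = ⊥-elim (impossible ⌊ w ≟ w′ ⌋ e)

  -- The cylinder V(G) × S over a vertex set S of H.
  cylinder : Subset (n H) → Subset (n (G □ H))
  cylinder S = concat (replicate (n G) S)

  ∣cylinder∣ : ∀ S → ∣ cylinder S ∣ ≡ n G * ∣ S ∣
  ∣cylinder∣ = ∣concat-replicate∣ (n G)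

  lookup-cylinder : ∀ S x → Vec.lookup (cylinder S) x ≡ Vec.lookup S (πH x)
  lookup-cylinder S x = begin
    Vec.lookup (cylinder S) x                             ≡⟨ cong (Vec.lookup (cylinder S)) (sym (combine-π x)) ⟩
    Vec.lookup (cylinder S) (combine (πG x) (πH x))       ≡⟨ lookup-concat (replicate (n G) S) (πG x) (πH x) ⟩
    Vec.lookup (Vec.lookup (replicate (n G) S) (πG x)) (πH x)
                                                          ≡⟨ cong (λ row → Vec.lookup row (πH x)) (lookup-replicate (πG x) S) ⟩
    Vec.lookup S (πH x)                                   ∎
    where open ≡-Reasoning

  ∈-cylinder : ∀ {S x} → x ∈ cylinder S ⇔ πH x ∈ S
  ∈-cylinder {S} {x} = mk⇔
    (λ x∈ → lookup⇒[]= (πH x) S (trans (sym (lookup-cylinder S x)) ([]=⇒lookup x∈)))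
    (λ πx∈ → lookup⇒[]= x (cylinder S) (trans (lookup-cylinder S x) ([]=⇒lookup πx∈)))

  module _ {S : Subset (n H)} where

    ∉-cylinder⁻ : ∀ {x} → x ∉ cylinder S → πH x ∉ S
    ∉-cylinder⁻ x∉ πx∈ = x∉ (Equivalence.from ∈-cylinder πx∈)

    combine∉ : ∀ w {t} → t ∉ S → combine w t ∉ cylinder S
    combine∉ w {t} t∉ x∈ = t∉ (subst (_∈ S) (πH-combine w t) (Equivalence.to ∈-cylinder x∈))

    project : ∀ {x y} → Reach (G □ H) (cylinder S) x y → Reach H S (πH x) (πH y)
    project (here x∉) = here (∉-cylinder⁻ x∉)
    project (step {w = y} x∉ e r) with □-adj⁻ _ y e
    ... | inj₁ edge = step (∉-cylinder⁻ x∉) edge (project r)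
    ... | inj₂ same = subst (λ t → Reach H S t _) (sym same) (project r)

    liftH : ∀ w {t t′} → Reach H S t t′ → Reach (G □ H) (cylinder S) (combine w t) (combine w t′)
    liftH w (here t∉) = here (combine∉ w t∉)
    liftH w (step t∉ e r) = step (combine∉ w t∉) (□-edgeH w e) (liftH w r)

    liftG : ∀ {w w′ t} → t ∉ S → Walk G w w′ → Reach (G □ H) (cylinder S) (combine w t) (combine w′ t)
    liftG t∉ (here _) = here (combine∉ _ t∉)
    liftG t∉ (step _ e r) = step (combine∉ _ t∉) (□-edgeG _ e) (liftG t∉ r)

    lift : (∀ w w′ → Walk G w w′) → ∀ {x y} → Reach H S (πH x) (πH y) → Reach (G □ H) (cylinder S) x y
    lift connected {x} {y} r =
      subst₂ (Reach (G □ H) (cylinder S)) (combine-π x) (combine-π y)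
        (liftG (start∉ r) (connected (πG x) (πG y)) ++ᴿ liftH (πG y) r)

    cylinder-components : Connected G → ∀ {k} → Components H S k → Components (G □ H) (cylinder S) k
    cylinder-components (nonempty , connected) {k} (f , onto , fibres) = F , F-onto , F-fibres
      where
      F : (x : Fin (n (G □ H))) → x ∉ cylinder S → Fin k
      F x x∉ = f (πH x) (∉-cylinder⁻ x∉)
      w₀ : Fin (n G)
      w₀ = fromℕ< nonempty
      F-onto : ∀ i → ∃ λ x → Σ (x ∉ cylinder S) λ x∉ → F x x∉ ≡ i
      F-onto i =
        let (t , t∉ , ft) = onto i
            x∉ = combine∉ w₀ t∉
            back = subst (λ s → Reach H S s t) (sym (πH-combine w₀ t)) (here t∉)
        in combine w₀ t , x∉ , trans (Equivalence.from (fibres _ t (∉-cylinder⁻ x∉) t∉) back) ft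
      F-fibres : ∀ x y x∉ y∉ → (F x x∉ ≡ F y y∉) ⇔ Reach (G □ H) (cylinder S) x y
      F-fibres x y x∉ y∉ = mk⇔
        (λ same → lift connected (Equivalence.to (fibres _ _ _ _) same))
        (λ r → Equivalence.from (fibres _ _ _ _) (project r))

below-Δ : ∀ G {m} → m < Δ G → ∃ λ v → m < degree G v
below-Δ G {m} m<Δ with foldr-selective {_•_ = _⊔_} ⊔-sel 0 (map (degree G) (allFin (n G)))
... | inj₁ Δ≡0 = ⊥-elim (n≮0 (subst (m <_) Δ≡0 m<Δ))
... | inj₂ Δ∈ with ∈-map⁻ (degree G) Δ∈
...   | v , _ , Δ≡deg = v , subst (m <_) Δ≡deg m<Δ

lemma3p2 : (G₁ T : Graph) → Connected G₁ → IsTree T → order G₁ < Δ T → ¬ OneTough (G₁ □ T)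
lemma3p2 G₁ T connected₁ tree n₁<Δ tough = <⇒≱ n₁<deg deg≤n₁
  where
  open ≤-Reasoning
  v : Fin (n T)
  v = proj₁ (below-Δ T n₁<Δ)
  n₁<deg : n G₁ < degree T v
  n₁<deg = proj₂ (below-Δ T n₁<Δ)
  S : Subset (n (G₁ □ T))
  S = cylinder G₁ T ⁅ v ⁆
  separation : Components (G₁ □ T) S (degree T v)
  separation = cylinder-components G₁ T connected₁ (TreeMinusVertex.components T tree v)
  deg≤n₁ : degree T v ≤ n G₁
  deg≤n₁ = begin
    degree T v        ≤⟨ tough S (degree T v) separation (≤-trans (s≤s (proj₁ connected₁)) n₁<deg) ⟩
    ∣ S ∣             ≡⟨ ∣cylinder∣ G₁ T ⁅ v ⁆ ⟩
    n G₁ * ∣ ⁅ v ⁆ ∣  ≡⟨ cong (n G₁ *_) (∣⁅x⁆∣≡1 v) ⟩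
    n G₁ * 1          ≡⟨ *-identityʳ (n G₁) ⟩
    n G₁              ∎
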